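{- Let $k\ge1$ and let $\mu$ be a weakly decreasing sequence $\mu_1\ge\cdots\ge\mu_k$ of nonnegative integers in which each integer $j\ge0$ occurs exactly $s_j$ times. Then $$w_k(\mu)=\frac{1}{\prod_{j\ge0}s_j!\,\prod_{j\ge0}((2j+1)!)^{s_j}}.$$
   Context: $\mathcal P_k(\mu)$ denotes the set of all $\nu=(\nu_1,\dots,\nu_k)\in\mathbb{Z}_{\ge0}^k$ which are rearrangements of $\mu$ (i.e. each $j\ge0$ occurs in $\nu$ exactly $s_j$ times). Define $$w_k(\mu)=\sum_{\nu\in\mathcal P_k(\mu)}\frac{1}{\prod_{j=1}^k(2\nu_1+\cdots+2\nu_j+j)\cdot\prod_{j=1}^k(2\nu_j)!}.$$ -}

module Defs where

open import Data.Nat as ℕ using (ℕ; zero; suc; _≤_; _⊔_; _!)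
open import Data.Bool using (Bool; true; false; _∧_)
open import Data.List as L using (List; []; _∷_; upTo; concatMap; map; filterᵇ; foldr)
open import Data.Vec as V using (Vec; []; _∷_)
open import Data.Rational as ℚ using (ℚ; 0ℚ; 1ℚ; _+_; _*_)
open import Data.Integer using (+_)

count : ℕ → ∀ {k} → Vec ℕ k → ℕ
count j [] = 0
count j (x ∷ xs) with j ℕ.≡ᵇ x
... | true  = suc (count j xs)
... | false = count j xs

data Decreasing : ∀ {k} → Vec ℕ k → Set where
  dec-[]  : Decreasing []
  dec-one : ∀ x → Decreasing (x ∷ [])
  dec-∷   : ∀ {k} x y (ys : Vec ℕ k) → y ≤ x → Decreasing (y ∷ ys) → Decreasing (x ∷ y ∷ ys)

maxV : ∀ {k} → Vec ℕ k → ℕ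
maxV [] = 0
maxV (x ∷ xs) = x ⊔ maxV xs

allVecs : ℕ → (k : ℕ) → List (Vec ℕ k)
allVecs M zero = [] ∷ []
allVecs M (suc k) = concatMap (λ x → map (x ∷_) (allVecs M k)) (upTo (suc M))

-- ν is a rearrangement of μ: every j occurs equally often.
-- (Entries of ν are ≤ M = max μ in the enumeration, so it suffices to test j ≤ M.)
isRearrᵇ : ∀ {k} → ℕ → Vec ℕ k → Vec ℕ k → Bool
isRearrᵇ M ν μ = foldr (λ j b → (count j ν ℕ.≡ᵇ count j μ) ∧ b) true (upTo (suc M))

-- 𝒫_k(μ) : the (duplicate-free) list of all rearrangements of μ
𝒫 : ∀ {k} → Vec ℕ k → List (Vec ℕ k)
𝒫 {k} μ = filterᵇ (λ ν → isRearrᵇ (maxV μ) ν μ) (allVecs (maxV μ) k)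

-- 1/n as a rational (only ever applied to positive n below; 1/0 := 0 is a dummy)
recipℕ : ℕ → ℚ
recipℕ zero = 0ℚ
recipℕ (suc n) = + 1 ℚ./ suc n

sumℚ : List ℚ → ℚ
sumℚ = foldr _+_ 0ℚ

prodℚ : List ℚ → ℚ
prodℚ = foldr _*_ 1ℚ

-- ∏_{j=1}^k (2ν₁+⋯+2ν_j + j), computed with running partial sum
partialProd : ℕ → ℕ → ∀ {k} → Vec ℕ k → ℕ
partialProd s j [] = 1
partialProd s j (x ∷ xs) = (s ℕ.+ 2 ℕ.* x ℕ.+ suc j) ℕ.* partialProd (s ℕ.+ 2 ℕ.* x) (suc j) xs

factProd : ∀ {k} → Vec ℕ k → ℕ
factProd [] = 1
factProd (x ∷ xs) = ((2 ℕ.* x) !) ℕ.* factProd xs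

term : ∀ {k} → Vec ℕ k → ℚ
term ν = recipℕ (partialProd 0 0 ν ℕ.* factProd ν)

w : ∀ {k} → Vec ℕ k → ℚ
w μ = sumℚ (map term (𝒫 μ))

-- right-hand side:  1 / (∏_{j≥0} s_j! · ∏_{j≥0} ((2j+1)!)^{s_j}),  s_j = count j μ.
-- Factors with j > max μ have s_j = 0 and equal 1, so the products run over j ≤ max μ.
rhsDenom : ∀ {k} → Vec ℕ k → ℕ
rhsDenom μ = foldr (λ j p → ((count j μ) ! ℕ.* ((suc (2 ℕ.* j)) !) ℕ.^ count j μ) ℕ.* p) 1 (upTo (suc (maxV μ)))

module Submission where

-- The proof generalises from μ to an arbitrary multiplicity profile c : ℕ → ℕ on the alphabet
-- {0,…,M} (c j letters j) and proves, by induction on the length k = Σ_j c_j, that the sum of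
-- term ν over all words ν of profile c equals 1 / ∏_j c_j! ((2j+1)!)^{c_j} (profileSum-closed).
-- The induction splits off the LAST letter y of ν: the last factor of ∏_i(2ν₁+⋯+2νᵢ+i) is the
-- total weight W = Σ_j c_j(2j+1), which depends only on c, so term (ν ∷ʳ y) = term ν / (W (2y)!)
-- and ν ranges over the words of profile "c minus y".  By induction each letter y contributes
-- c_y(2y+1) / (W · ∏_j c_j! ((2j+1)!)^{c_j}), and these contributions add up to the claim
-- because Σ_y c_y(2y+1) = W.  Nothing uses that μ is decreasing or that k ≥ 1.

open import Defs
open import Data.Nat using (ℕ; suc; _≥_)
open import Data.Vec using (Vec)
open import Relation.Binary.PropositionalEquality using (_≡_)

open import Algebra.Bundles using (CommutativeMonoid)
import Algebra.Properties.CommutativeSemigroup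
open import Data.Bool using (Bool; true; false; T; _∧_; if_then_else_)
open import Data.Bool.Properties using (T-≡; T-∧)
open import Data.Empty using (⊥-elim)
open import Data.Integer as ℤ using ()
import Data.Integer.Properties as ZP
open import Data.List using (List; []; _∷_; _++_; map; concatMap; filterᵇ; foldr; upTo)
open import Data.List.Membership.Propositional using (_∈_)
open import Data.List.Membership.Propositional.Properties using (∈-upTo⁺)
open import Data.List.Relation.Unary.All as All using (All; []; _∷_)
open import Data.List.Relation.Unary.All.Properties using (all-upTo; concat⁺; map⁺)
open import Data.List.Relation.Unary.AllPairs using ([]; _∷_)
open import Data.List.Relation.Unary.Any using (here; there)
open import Data.List.Relation.Unary.Unique.Propositional using (Unique)
open import Data.List.Relation.Unary.Unique.Propositional.Properties using (upTo⁺)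
open import Data.Nat as ℕ using (zero; _!)
import Data.Nat.Properties as NP
open import Data.Nat.Tactic.RingSolver using (solve-∀)
open import Data.Product using (_,_)
open import Data.Rational as ℚ using (ℚ; 0ℚ; 1ℚ; _+_; _*_; toℚᵘ)
import Data.Rational.Properties as QP
open import Data.Rational.Unnormalised using (mkℚᵘ; _≃_; *≡*)
import Data.Rational.Unnormalised.Properties as UP
open import Data.Vec using ([]; _∷_; _∷ʳ_)
import Data.Vec as V
import Data.Vec.Relation.Unary.All as VA
open import Function.Bundles using (Equivalence)
open import Relation.Binary.PropositionalEquality using (_≢_; refl; ≢-sym; sym; trans; cong; cong₂; module ≡-Reasoning)
open import Relation.Nullary using (yes; no)

alphabet : ℕ → List ℕ
alphabet M = upTo (suc M)

module Sum {c ℓ} (𝕄 : CommutativeMonoid c ℓ) where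
  open CommutativeMonoid 𝕄 renaming (refl to ≈-refl; sym to ≈-sym; trans to ≈-trans)
  open import Algebra.Properties.CommutativeSemigroup commutativeSemigroup
    using (interchange; xy∙z≈zy∙x)
  open import Relation.Binary.Reasoning.Setoid setoid

  ∑ : {B : Set} → List B → (B → Carrier) → Carrier
  ∑ xs f = foldr (λ x s → f x ∙ s) ε xs

  ∑-foldr-map : ∀ {B : Set} (xs : List B) (f : B → Carrier) → foldr _∙_ ε (map f xs) ≈ ∑ xs f
  ∑-foldr-map [] f = ≈-refl
  ∑-foldr-map (x ∷ xs) f = ∙-congˡ (∑-foldr-map xs f)

  ∑-congᴬ : ∀ {B : Set} {P : B → Set} {xs : List B} {f g : B → Carrier} →
            (∀ {x} → P x → f x ≈ g x) → All P xs → ∑ xs f ≈ ∑ xs g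
  ∑-congᴬ f≈g [] = ≈-refl
  ∑-congᴬ f≈g (px ∷ pxs) = ∙-cong (f≈g px) (∑-congᴬ f≈g pxs)

  ∑-cong : ∀ {B : Set} (xs : List B) {f g : B → Carrier} → (∀ x → f x ≈ g x) → ∑ xs f ≈ ∑ xs g
  ∑-cong [] f≈g = ≈-refl
  ∑-cong (x ∷ xs) f≈g = ∙-cong (f≈g x) (∑-cong xs f≈g)

  ∑-++ : ∀ {B : Set} (xs ys : List B) (f : B → Carrier) → ∑ (xs ++ ys) f ≈ ∑ xs f ∙ ∑ ys f
  ∑-++ [] ys f = ≈-sym (identityˡ _)
  ∑-++ (x ∷ xs) ys f = ≈-trans (∙-congˡ (∑-++ xs ys f)) (≈-sym (assoc _ _ _))

  ∑-concatMap : ∀ {B C : Set} (xs : List B) (g : B → List C) (f : C → Carrier) →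
                ∑ (concatMap g xs) f ≈ ∑ xs (λ x → ∑ (g x) f)
  ∑-concatMap [] g f = ≈-refl
  ∑-concatMap (x ∷ xs) g f = ≈-trans (∑-++ (g x) _ f) (∙-congˡ (∑-concatMap xs g f))

  ∑-map : ∀ {B C : Set} (xs : List B) (h : B → C) (f : C → Carrier) → ∑ (map h xs) f ≈ ∑ xs (λ x → f (h x))
  ∑-map [] h f = ≈-refl
  ∑-map (x ∷ xs) h f = ∙-congˡ (∑-map xs h f)

  ∑-filter : ∀ {B : Set} (xs : List B) (p : B → Bool) (f : B → Carrier) →
             ∑ (filterᵇ p xs) f ≈ ∑ xs (λ x → if p x then f x else ε)
  ∑-filter [] p f = ≈-refl
  ∑-filter (x ∷ xs) p f with p x
  ... | true  = ∙-congˡ (∑-filter xs p f)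
  ... | false = ≈-trans (∑-filter xs p f) (≈-sym (identityˡ _))

  ∑-ε : ∀ {B : Set} (xs : List B) → ∑ xs (λ _ → ε) ≈ ε
  ∑-ε [] = ≈-refl
  ∑-ε (x ∷ xs) = ≈-trans (identityˡ _) (∑-ε xs)

  ∑-∙ : ∀ {B : Set} (xs : List B) (f g : B → Carrier) → ∑ xs (λ x → f x ∙ g x) ≈ ∑ xs f ∙ ∑ xs g
  ∑-∙ [] f g = ≈-sym (identityˡ ε)
  ∑-∙ (x ∷ xs) f g = ≈-trans (∙-congˡ (∑-∙ xs f g)) (interchange (f x) (g x) _ _)

  ∑-swap : ∀ {B C : Set} (xs : List B) (ys : List C) (f : B → C → Carrier) →
           ∑ xs (λ x → ∑ ys (f x)) ≈ ∑ ys (λ y → ∑ xs (λ x → f x y))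
  ∑-swap [] ys f = ≈-sym (∑-ε ys)
  ∑-swap (x ∷ xs) ys f = ≈-trans (∙-congˡ (∑-swap xs ys f)) (≈-sym (∑-∙ ys (f x) _))

  ∑-update : ∀ {B : Set} {xs : List B} {y : B} (f g : B → Carrier) → (∀ j → j ≢ y → f j ≈ g j) →
             Unique xs → y ∈ xs → ∑ xs f ∙ g y ≈ ∑ xs g ∙ f y
  ∑-update {xs = y ∷ ys} f g f≈g (y∉ys ∷ _) (here refl) = begin
    (f y ∙ ∑ ys f) ∙ g y ≈⟨ ∙-congʳ (∙-congˡ (∑-congᴬ (λ y≢j → f≈g _ (≢-sym y≢j)) y∉ys)) ⟩
    (f y ∙ ∑ ys g) ∙ g y ≈⟨ xy∙z≈zy∙x (f y) _ (g y) ⟩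
    (g y ∙ ∑ ys g) ∙ f y ∎
  ∑-update {xs = x ∷ ys} {y} f g f≈g (x∉ys ∷ ys-unique) (there y∈ys) = begin
    (f x ∙ ∑ ys f) ∙ g y ≈⟨ assoc _ _ _ ⟩
    f x ∙ (∑ ys f ∙ g y) ≈⟨ ∙-cong (f≈g x (All.lookup x∉ys y∈ys)) (∑-update f g f≈g ys-unique y∈ys) ⟩
    g x ∙ (∑ ys g ∙ f y) ≈⟨ ≈-sym (assoc _ _ _) ⟩
    (g x ∙ ∑ ys g) ∙ f y ∎

  ∑-single : ∀ {B : Set} {xs : List B} {y : B} (f : B → Carrier) → (∀ j → j ≢ y → f j ≈ ε) →
             Unique xs → y ∈ xs → ∑ xs f ≈ f y
  ∑-single {xs = xs} {y} f f≈ε unique y∈xs = begin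
    ∑ xs f                   ≈⟨ ≈-sym (identityʳ _) ⟩
    ∑ xs f ∙ ε               ≈⟨ ∑-update f (λ _ → ε) f≈ε unique y∈xs ⟩
    ∑ xs (λ _ → ε) ∙ f y     ≈⟨ ∙-congʳ (∑-ε xs) ⟩
    ε ∙ f y                  ≈⟨ identityˡ _ ⟩
    f y ∎

  ∑-allVecs-∷ : ∀ M k (f : Vec ℕ (suc k) → Carrier) →
    ∑ (allVecs M (suc k)) f ≈ ∑ (alphabet M) (λ x → ∑ (allVecs M k) (λ ν → f (x ∷ ν)))
  ∑-allVecs-∷ M k f = ≈-trans (∑-concatMap (alphabet M) (λ x → map (x ∷_) (allVecs M k)) f)
                              (∑-cong (alphabet M) (λ x → ∑-map (allVecs M k) (x ∷_) f))

  ∑-allVecs-∷ʳ : ∀ M k (f : Vec ℕ (suc k) → Carrier) →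
    ∑ (allVecs M (suc k)) f ≈ ∑ (allVecs M k) (λ ν → ∑ (alphabet M) (λ y → f (ν ∷ʳ y)))
  ∑-allVecs-∷ʳ M zero f = begin
    ∑ (allVecs M 1) f                          ≈⟨ ∑-allVecs-∷ M zero f ⟩
    ∑ (alphabet M) (λ y → f (y ∷ []) ∙ ε)      ≈⟨ ∑-cong (alphabet M) (λ y → identityʳ _) ⟩
    ∑ (alphabet M) (λ y → f (y ∷ []))          ≈⟨ ≈-sym (identityʳ _) ⟩
    ∑ (alphabet M) (λ y → f (y ∷ [])) ∙ ε      ∎
  ∑-allVecs-∷ʳ M (suc k) f = begin
    ∑ (allVecs M (suc (suc k))) f
      ≈⟨ ∑-allVecs-∷ M (suc k) f ⟩
    ∑ (alphabet M) (λ x → ∑ (allVecs M (suc k)) (λ ν → f (x ∷ ν)))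
      ≈⟨ ∑-cong (alphabet M) (λ x → ∑-allVecs-∷ʳ M k (λ ν → f (x ∷ ν))) ⟩
    ∑ (alphabet M) (λ x → ∑ (allVecs M k) (λ ν → ∑ (alphabet M) (λ y → f (x ∷ (ν ∷ʳ y)))))
      ≈⟨ ≈-sym (∑-allVecs-∷ M k _) ⟩
    ∑ (allVecs M (suc k)) (λ ν → ∑ (alphabet M) (λ y → f (ν ∷ʳ y))) ∎

module ℕ+ = Sum NP.+-0-commutativeMonoid
module ℕ* = Sum NP.*-1-commutativeMonoid
module ℚ+ = Sum QP.+-0-commutativeMonoid
module ℚ* = Algebra.Properties.CommutativeSemigroup (CommutativeMonoid.commutativeSemigroup QP.*-1-commutativeMonoid)

ι : ℕ → ℚ
ι n = ℤ.+ n ℚ./ 1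

toℚᵘ-ι : ∀ n → toℚᵘ (ι n) ≃ mkℚᵘ (ℤ.+ n) 0
toℚᵘ-ι n = QP.toℚᵘ-fromℚᵘ (mkℚᵘ (ℤ.+ n) 0)

toℚᵘ-recipℕ : ∀ n → toℚᵘ (recipℕ (suc n)) ≃ mkℚᵘ (ℤ.+ 1) n
toℚᵘ-recipℕ n = QP.toℚᵘ-fromℚᵘ (mkℚᵘ (ℤ.+ 1) n)

ι-+ : ∀ m n → ι (m ℕ.+ n) ≡ ι m + ι n
ι-+ m n = QP.toℚᵘ-injective (UP.≃-trans (toℚᵘ-ι (m ℕ.+ n)) (UP.≃-sym (UP.≃-trans
  (QP.toℚᵘ-homo-+ (ι m) (ι n))
  (UP.≃-trans (UP.+-cong (toℚᵘ-ι m) (toℚᵘ-ι n)) (*≡* cross)))))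
  where
  cross : (ℤ.+ m ℤ.* ℤ.+ 1 ℤ.+ ℤ.+ n ℤ.* ℤ.+ 1) ℤ.* ℤ.+ 1 ≡ ℤ.+ (m ℕ.+ n) ℤ.* ℤ.+ 1
  cross = trans (ZP.*-identityʳ _) (trans (cong₂ ℤ._+_ (ZP.*-identityʳ (ℤ.+ m)) (ZP.*-identityʳ (ℤ.+ n)))
                (trans (sym (ZP.pos-+ m n)) (sym (ZP.*-identityʳ _))))

-- recipℕ is multiplicative (also when a factor is 0, thanks to the convention 1/0 := 0).
recipℕ-* : ∀ a b → recipℕ (a ℕ.* b) ≡ recipℕ a * recipℕ b
recipℕ-* zero b = sym (QP.*-zeroˡ (recipℕ b))
recipℕ-* (suc a) zero rewrite NP.*-zeroʳ a = sym (QP.*-zeroʳ (recipℕ (suc a)))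
recipℕ-* (suc a) (suc b) = QP.toℚᵘ-injective (UP.≃-trans (toℚᵘ-recipℕ _) (UP.≃-sym (UP.≃-trans
  (QP.toℚᵘ-homo-* (recipℕ (suc a)) (recipℕ (suc b)))
  (UP.*-cong (toℚᵘ-recipℕ a) (toℚᵘ-recipℕ b)))))

ι-recipℕ : ∀ n → ι (suc n) * recipℕ (suc n) ≡ 1ℚ
ι-recipℕ n = QP.toℚᵘ-injective (UP.≃-trans (QP.toℚᵘ-homo-* (ι (suc n)) (recipℕ (suc n)))
  (UP.≃-trans (UP.*-cong (toℚᵘ-ι (suc n)) (toℚᵘ-recipℕ n)) (*≡* (cong (λ m → ℤ.+ suc m) cross))))
  where
  cross : n ℕ.* 1 ℕ.* 1 ≡ n ℕ.+ 0 ℕ.+ 0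
  cross = trans (trans (NP.*-identityʳ _) (NP.*-identityʳ n)) (sym (trans (NP.+-identityʳ _) (NP.+-identityʳ n)))

recipℕ-cancel : ∀ {n} X → 0 ℕ.< n → recipℕ (n ℕ.* X) * ι n ≡ recipℕ X
recipℕ-cancel {suc m} X _ = begin
  recipℕ (suc m ℕ.* X) * ι (suc m)              ≡⟨ cong (_* ι (suc m)) (recipℕ-* (suc m) X) ⟩
  recipℕ (suc m) * recipℕ X * ι (suc m)         ≡⟨ ℚ*.xy∙z≈zx∙y (recipℕ (suc m)) (recipℕ X) (ι (suc m)) ⟩
  (ι (suc m) * recipℕ (suc m)) * recipℕ X       ≡⟨ cong (_* recipℕ X) (ι-recipℕ m) ⟩
  1ℚ * recipℕ X                                 ≡⟨ QP.*-identityˡ _ ⟩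
  recipℕ X                                      ∎
  where open ≡-Reasoning

∑-ι : ∀ {B : Set} (xs : List B) (f : B → ℕ) → ℚ+.∑ xs (λ x → ι (f x)) ≡ ι (ℕ+.∑ xs f)
∑-ι [] f = refl
∑-ι (x ∷ xs) f = trans (cong (ι (f x) +_) (∑-ι xs f)) (sym (ι-+ (f x) _))

*-∑ : ∀ {B : Set} (q : ℚ) (xs : List B) (f : B → ℚ) → q * ℚ+.∑ xs f ≡ ℚ+.∑ xs (λ x → q * f x)
*-∑ q [] f = QP.*-zeroʳ q
*-∑ q (x ∷ xs) f = trans (QP.*-distribˡ-+ q (f x) _) (cong (q * f x +_) (*-∑ q xs f))

≡ᵇ-refl : ∀ j → (j ℕ.≡ᵇ j) ≡ true
≡ᵇ-refl j = T-≡ .Equivalence.to (NP.≡⇒≡ᵇ j j refl)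

≡ᵇ-false : ∀ {j x} → j ≢ x → (j ℕ.≡ᵇ x) ≡ false
≡ᵇ-false {j} {x} j≢x with j ℕ.≡ᵇ x in eq
... | true  = ⊥-elim (j≢x (NP.≡ᵇ⇒≡ j x (T-≡ .Equivalence.from eq)))
... | false = refl

count-∷ : ∀ j x {k} (ν : Vec ℕ k) → count j (x ∷ ν) ≡ (if j ℕ.≡ᵇ x then suc (count j ν) else count j ν)
count-∷ j x ν with j ℕ.≡ᵇ x
... | true  = refl
... | false = refl

count-here : ∀ y {k} (ν : Vec ℕ k) → count y (y ∷ ν) ≡ suc (count y ν)
count-here y ν rewrite ≡ᵇ-refl y = refl

count-∷ʳ : ∀ j y {k} (ν : Vec ℕ k) → count j (ν ∷ʳ y) ≡ count j (y ∷ ν)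
count-∷ʳ j y [] = refl
count-∷ʳ j y (x ∷ ν) rewrite count-∷ j x (ν ∷ʳ y) | count-∷ʳ j y ν | count-∷ j y (x ∷ ν)
                           | count-∷ j y ν | count-∷ j x ν with j ℕ.≡ᵇ x | j ℕ.≡ᵇ y
... | true  | true  = refl
... | true  | false = refl
... | false | true  = refl
... | false | false = refl

count-∑ : ∀ M (g : ℕ → ℕ) {k} (ν : Vec ℕ k) → VA.All (ℕ._< suc M) ν →
          ℕ+.∑ (alphabet M) (λ j → count j ν ℕ.* g j) ≡ V.sum (V.map g ν)
count-∑ M g [] _ = ℕ+.∑-ε (alphabet M)
count-∑ M g (x ∷ ν) (x≤M VA.∷ ν≤M) = begin
  ℕ+.∑ (alphabet M) (λ j → count j (x ∷ ν) ℕ.* g j)                  ≡⟨ ℕ+.∑-cong (alphabet M) split ⟩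
  ℕ+.∑ (alphabet M) (λ j → δ j ℕ.+ count j ν ℕ.* g j)                ≡⟨ ℕ+.∑-∙ (alphabet M) δ _ ⟩
  ℕ+.∑ (alphabet M) δ ℕ.+ ℕ+.∑ (alphabet M) (λ j → count j ν ℕ.* g j) ≡⟨ cong₂ ℕ._+_ δ-sum (count-∑ M g ν ν≤M) ⟩
  g x ℕ.+ V.sum (V.map g ν)                                         ∎
  where
  open ≡-Reasoning
  δ : ℕ → ℕ
  δ j = if j ℕ.≡ᵇ x then g j else 0
  split : ∀ j → count j (x ∷ ν) ℕ.* g j ≡ δ j ℕ.+ count j ν ℕ.* g j
  split j rewrite count-∷ j x ν with j ℕ.≡ᵇ x
  ... | true  = refl
  ... | false = refl
  δ-sum : ℕ+.∑ (alphabet M) δ ≡ g x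
  δ-sum = trans (ℕ+.∑-single δ (λ j j≢x → cong (λ b → if b then g j else 0) (≡ᵇ-false j≢x))
                             (upTo⁺ (suc M)) (∈-upTo⁺ x≤M))
                (cong (λ b → if b then g x else 0) (≡ᵇ-refl x))

allᵇ : List ℕ → (ℕ → Bool) → Bool
allᵇ xs p = foldr (λ j b → p j ∧ b) true xs

allᵇ-sound : ∀ xs (p : ℕ → Bool) → T (allᵇ xs p) → All (λ j → T (p j)) xs
allᵇ-sound [] p _ = []
allᵇ-sound (x ∷ xs) p t with T-∧ .Equivalence.to t
... | px , pxs = px ∷ allᵇ-sound xs p pxs

allᵇ-complete : ∀ xs (p : ℕ → Bool) → All (λ j → T (p j)) xs → T (allᵇ xs p)
allᵇ-complete [] p [] = _
allᵇ-complete (x ∷ xs) p (px ∷ pxs) = T-∧ .Equivalence.from (px , allᵇ-complete xs p pxs)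

allᵇ-cong : ∀ xs {p q : ℕ → Bool} → (∀ j → p j ≡ q j) → allᵇ xs p ≡ allᵇ xs q
allᵇ-cong [] p≡q = refl
allᵇ-cong (x ∷ xs) p≡q = cong₂ _∧_ (p≡q x) (allᵇ-cong xs p≡q)

-- ν has the multiplicity profile c over {0,…,M}: each letter j ≤ M occurs exactly c j times.
-- A rearrangement of μ is precisely a word with the profile of μ (see isRearrᵇ).
hasProfile : ℕ → (ℕ → ℕ) → ∀ {k} → Vec ℕ k → Bool
hasProfile M c ν = allᵇ (alphabet M) (λ j → count j ν ℕ.≡ᵇ c j)

profile⇒counts : ∀ M c {k} (ν : Vec ℕ k) → T (hasProfile M c ν) → All (λ j → count j ν ≡ c j) (alphabet M)
profile⇒counts M c ν t = All.map (NP.≡ᵇ⇒≡ _ _) (allᵇ-sound (alphabet M) _ t)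

remove : ℕ → (ℕ → ℕ) → ℕ → ℕ
remove y c j = if j ℕ.≡ᵇ y then ℕ.pred (c j) else c j

remove-at : ∀ y c → remove y c y ≡ ℕ.pred (c y)
remove-at y c rewrite ≡ᵇ-refl y = refl

remove-off : ∀ y c {j} → j ≢ y → remove y c j ≡ c j
remove-off y c j≢y rewrite ≡ᵇ-false j≢y = refl

profile-∷ʳ-absent : ∀ M c {k} (ν : Vec ℕ k) {y} → y ℕ.< suc M → c y ≡ 0 → hasProfile M c (ν ∷ʳ y) ≡ false
profile-∷ʳ-absent M c ν {y} y≤M cy≡0 with hasProfile M c (ν ∷ʳ y) in h
... | false = refl
... | true  = ⊥-elim (NP.1+n≢0 (begin
  suc (count y ν)   ≡⟨ sym (trans (count-∷ʳ y y ν) (count-here y ν)) ⟩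
  count y (ν ∷ʳ y)  ≡⟨ All.lookup (profile⇒counts M c (ν ∷ʳ y) (T-≡ .Equivalence.from h)) (∈-upTo⁺ y≤M) ⟩
  c y               ≡⟨ cy≡0 ⟩
  0                 ∎))
  where open ≡-Reasoning

profile-∷ʳ : ∀ M c {k} (ν : Vec ℕ k) {y t} → c y ≡ suc t → hasProfile M c (ν ∷ʳ y) ≡ hasProfile M (remove y c) ν
profile-∷ʳ M c ν {y} {t} cy≡1+t = allᵇ-cong (alphabet M) letterwise
  where
  letterwise : ∀ j → (count j (ν ∷ʳ y) ℕ.≡ᵇ c j) ≡ (count j ν ℕ.≡ᵇ remove y c j)
  letterwise j rewrite count-∷ʳ j y ν with j ℕ.≟ y
  ... | yes refl rewrite ≡ᵇ-refl j | cy≡1+t = refl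
  ... | no j≢y   rewrite ≡ᵇ-false j≢y = refl

-- Each letter x contributes 2x+1 to the partial sums 2ν₁+⋯+2νⱼ+j.
weight : ℕ → ℕ
weight x = suc (2 ℕ.* x)

-- The total weight Σ_j c_j(2j+1) of a profile; for a word ν of profile c it is 2(ν₁+⋯+ν_k)+k.
totalWeight : ℕ → (ℕ → ℕ) → ℕ
totalWeight M c = ℕ+.∑ (alphabet M) (λ j → c j ℕ.* weight j)

profile⇒weight : ∀ M c {k} (ν : Vec ℕ k) → VA.All (ℕ._< suc M) ν → T (hasProfile M c ν) →
                 V.sum (V.map weight ν) ≡ totalWeight M c
profile⇒weight M c ν ν≤M t = trans (sym (count-∑ M weight ν ν≤M))
  (ℕ+.∑-congᴬ (λ {j} cj → cong (ℕ._* weight j) cj) (profile⇒counts M c ν t))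

-- Every letter has weight ≥ 1, so the total weight dominates the length Σ_j c_j.
length≤totalWeight : ∀ M c → ℕ+.∑ (alphabet M) c ℕ.≤ totalWeight M c
length≤totalWeight M c = go (alphabet M)
  where
  go : ∀ xs → ℕ+.∑ xs c ℕ.≤ ℕ+.∑ xs (λ j → c j ℕ.* weight j)
  go [] = ℕ.z≤n
  go (x ∷ xs) = NP.+-mono-≤ (NP.m≤m*n (c x) (weight x)) (go xs)

remove-length : ∀ M c {y t} → y ℕ.< suc M → c y ≡ suc t →
                ℕ+.∑ (alphabet M) c ≡ suc (ℕ+.∑ (alphabet M) (remove y c))
remove-length M c {y} {t} y≤M cy≡1+t = NP.+-cancelʳ-≡ t _ _ (begin
  ℕ+.∑ (alphabet M) c ℕ.+ t                     ≡⟨ cong (ℕ+.∑ (alphabet M) c ℕ.+_) (sym rem-y) ⟩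
  ℕ+.∑ (alphabet M) c ℕ.+ remove y c y          ≡⟨ ℕ+.∑-update c (remove y c) (λ j j≢y → sym (remove-off y c j≢y))
                                                                 (upTo⁺ (suc M)) (∈-upTo⁺ y≤M) ⟩
  ℕ+.∑ (alphabet M) (remove y c) ℕ.+ c y        ≡⟨ cong (ℕ+.∑ (alphabet M) (remove y c) ℕ.+_) cy≡1+t ⟩
  ℕ+.∑ (alphabet M) (remove y c) ℕ.+ suc t      ≡⟨ NP.+-suc _ t ⟩
  suc (ℕ+.∑ (alphabet M) (remove y c)) ℕ.+ t    ∎)
  where
  open ≡-Reasoning
  rem-y : remove y c y ≡ t
  rem-y = trans (remove-at y c) (cong ℕ.pred cy≡1+t)

partialProd-∷ʳ : ∀ s j {k} (ν : Vec ℕ k) y →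
  partialProd s j (ν ∷ʳ y) ≡ partialProd s j ν ℕ.* (s ℕ.+ j ℕ.+ V.sum (V.map weight (ν ∷ʳ y)))
partialProd-∷ʳ s j [] y = last s j y
  where
  last : ∀ s j y → (s ℕ.+ 2 ℕ.* y ℕ.+ suc j) ℕ.* 1 ≡ 1 ℕ.* (s ℕ.+ j ℕ.+ (suc (2 ℕ.* y) ℕ.+ 0))
  last = solve-∀
partialProd-∷ʳ s j (x ∷ ν) y rewrite partialProd-∷ʳ (s ℕ.+ 2 ℕ.* x) (suc j) ν y =
  regroup (s ℕ.+ 2 ℕ.* x ℕ.+ suc j) (partialProd (s ℕ.+ 2 ℕ.* x) (suc j) ν) s j x (V.sum (V.map weight (ν ∷ʳ y)))
  where
  regroup : ∀ a p s j x W → a ℕ.* (p ℕ.* (s ℕ.+ 2 ℕ.* x ℕ.+ suc j ℕ.+ W)) ≡ a ℕ.* p ℕ.* (s ℕ.+ j ℕ.+ (suc (2 ℕ.* x) ℕ.+ W))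
  regroup = solve-∀

factProd-∷ʳ : ∀ {k} (ν : Vec ℕ k) y → factProd (ν ∷ʳ y) ≡ factProd ν ℕ.* (2 ℕ.* y) !
factProd-∷ʳ [] y = trans (NP.*-identityʳ _) (sym (NP.*-identityˡ _))
factProd-∷ʳ (x ∷ ν) y rewrite factProd-∷ʳ ν y = sym (NP.*-assoc ((2 ℕ.* x) !) (factProd ν) ((2 ℕ.* y) !))

term-∷ʳ : ∀ {k} (ν : Vec ℕ k) y →
  term (ν ∷ʳ y) ≡ term ν * recipℕ (V.sum (V.map weight (ν ∷ʳ y)) ℕ.* (2 ℕ.* y) !)
term-∷ʳ ν y = trans (cong recipℕ denominator) (recipℕ-* (partialProd 0 0 ν ℕ.* factProd ν) _)
  where
  regroup : ∀ p W f F → p ℕ.* W ℕ.* (f ℕ.* F) ≡ p ℕ.* f ℕ.* (W ℕ.* F)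
  regroup = solve-∀
  denominator : partialProd 0 0 (ν ∷ʳ y) ℕ.* factProd (ν ∷ʳ y)
              ≡ partialProd 0 0 ν ℕ.* factProd ν ℕ.* (V.sum (V.map weight (ν ∷ʳ y)) ℕ.* (2 ℕ.* y) !)
  denominator = trans (cong₂ ℕ._*_ (partialProd-∷ʳ 0 0 ν y) (factProd-∷ʳ ν y))
                        (regroup (partialProd 0 0 ν) (V.sum (V.map weight (ν ∷ʳ y))) (factProd ν) ((2 ℕ.* y) !))

rhsFactor : (ℕ → ℕ) → ℕ → ℕ
rhsFactor c j = c j ! ℕ.* (weight j !) ℕ.^ c j

rhsFactor-nonZero : ∀ c j → ℕ.NonZero (rhsFactor c j)
rhsFactor-nonZero c j = NP.m*n≢0 (c j !) _ {{c j NP.!≢0}} {{NP.m^n≢0 (weight j !) (c j) {{weight j NP.!≢0}}}}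

-- ∏_{j ≤ M} c_j! · ((2j+1)!)^{c_j}; for the profile of μ this is rhsDenom μ.
rhsProd : ℕ → (ℕ → ℕ) → ℕ
rhsProd M c = ℕ*.∑ (alphabet M) (rhsFactor c)

rhs-remove : ∀ M c {y t} → y ℕ.< suc M → c y ≡ suc t →
  rhsProd M c ≡ (suc t ℕ.* weight y) ℕ.* ((2 ℕ.* y) ! ℕ.* rhsProd M (remove y c))
rhs-remove M c {y} {t} y≤M cy≡1+t =
  NP.*-cancelʳ-≡ (rhsProd M c) _ (rhsFactor c′ y) {{rhsFactor-nonZero c′ y}} (begin
    rhsProd M c ℕ.* rhsFactor c′ y   ≡⟨ ℕ*.∑-update (rhsFactor c) (rhsFactor c′) agree (upTo⁺ (suc M)) (∈-upTo⁺ y≤M) ⟩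
    rhsProd M c′ ℕ.* rhsFactor c y   ≡⟨ cong (rhsProd M c′ ℕ.*_) factor-y ⟩
    rhsProd M c′ ℕ.* (m ℕ.* F ℕ.* rhsFactor c′ y) ≡⟨ regroup (rhsProd M c′) m F _ ⟩
    m ℕ.* (F ℕ.* rhsProd M c′) ℕ.* rhsFactor c′ y ∎)
  where
  open ≡-Reasoning
  c′ = remove y c
  m = suc t ℕ.* weight y
  F = (2 ℕ.* y) !
  agree : ∀ j → j ≢ y → rhsFactor c j ≡ rhsFactor c′ j
  agree j j≢y = cong (λ n → n ! ℕ.* (weight j !) ℕ.^ n) (sym (remove-off y c j≢y))
  factor-y : rhsFactor c y ≡ m ℕ.* F ℕ.* rhsFactor c′ y
  factor-y rewrite remove-at y c | cy≡1+t = unfold t (t !) (weight y) F ((weight y !) ℕ.^ t)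
    where
    unfold : ∀ t a w F p → (suc t ℕ.* a) ℕ.* ((w ℕ.* F) ℕ.* p) ≡ suc t ℕ.* w ℕ.* F ℕ.* (a ℕ.* p)
    unfold = solve-∀
  regroup : ∀ R m F g → R ℕ.* (m ℕ.* F ℕ.* g) ≡ m ℕ.* (F ℕ.* R) ℕ.* g
  regroup = solve-∀

All-∷ʳ : ∀ {P : ℕ → Set} {k} {ν : Vec ℕ k} {y} → VA.All P ν → P y → VA.All P (ν ∷ʳ y)
All-∷ʳ VA.[] py = py VA.∷ VA.[]
All-∷ʳ (px VA.∷ pν) py = px VA.∷ All-∷ʳ pν py

allVecs-bounded : ∀ M k → All (VA.All (ℕ._< suc M)) (allVecs M k)
allVecs-bounded M zero = VA.[] ∷ []
allVecs-bounded M (suc k) =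
  concat⁺ (map⁺ (All.map (λ x≤M → map⁺ (All.map (x≤M VA.∷_) (allVecs-bounded M k))) (all-upTo (suc M))))

restrictedTerm : ℕ → (ℕ → ℕ) → ∀ {k} → Vec ℕ k → ℚ
restrictedTerm M c ν = if hasProfile M c ν then term ν else 0ℚ

profileSum : ℕ → ℕ → (ℕ → ℕ) → ℚ
profileSum M k c = ℚ+.∑ (allVecs M k) (restrictedTerm M c)

ifPos : ℕ → ℚ → ℚ
ifPos zero    q = 0ℚ
ifPos (suc _) q = q

lastLetter : ℕ → (ℕ → ℕ) → ℕ → ℚ
lastLetter M c y = ifPos (c y) (recipℕ (totalWeight M c ℕ.* (2 ℕ.* y) !))

restrictedTerm-∷ʳ : ∀ M c {k} {ν : Vec ℕ k} {y} → VA.All (ℕ._< suc M) ν → y ℕ.< suc M →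
  restrictedTerm M c (ν ∷ʳ y) ≡ lastLetter M c y * restrictedTerm M (remove y c) ν
restrictedTerm-∷ʳ M c {ν = ν} {y} ν≤M y≤M with c y in cy
... | zero rewrite profile-∷ʳ-absent M c ν y≤M cy = sym (QP.*-zeroˡ (restrictedTerm M (remove y c) ν))
... | suc t rewrite profile-∷ʳ M c ν cy with hasProfile M (remove y c) ν in h
...   | false = sym (QP.*-zeroʳ (recipℕ (totalWeight M c ℕ.* (2 ℕ.* y) !)))
...   | true  = begin
  term (ν ∷ʳ y)                                          ≡⟨ term-∷ʳ ν y ⟩
  term ν * recipℕ (V.sum (V.map weight (ν ∷ʳ y)) ℕ.* F)  ≡⟨ cong (λ W → term ν * recipℕ (W ℕ.* F)) weight≡ ⟩
  term ν * recipℕ (totalWeight M c ℕ.* F)                ≡⟨ QP.*-comm (term ν) _ ⟩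
  recipℕ (totalWeight M c ℕ.* F) * term ν                ∎
  where
  open ≡-Reasoning
  F = (2 ℕ.* y) !
  weight≡ : V.sum (V.map weight (ν ∷ʳ y)) ≡ totalWeight M c
  weight≡ = profile⇒weight M c (ν ∷ʳ y) (All-∷ʳ ν≤M y≤M)
                           (T-≡ .Equivalence.from (trans (profile-∷ʳ M c ν cy) h))

profileSum-∷ʳ : ∀ M k c →
  profileSum M (suc k) c ≡ ℚ+.∑ (alphabet M) (λ y → lastLetter M c y * profileSum M k (remove y c))
profileSum-∷ʳ M k c = begin
  profileSum M (suc k) c
    ≡⟨ ℚ+.∑-allVecs-∷ʳ M k (restrictedTerm M c) ⟩
  ℚ+.∑ (allVecs M k) (λ ν → ℚ+.∑ (alphabet M) (λ y → restrictedTerm M c (ν ∷ʳ y)))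
    ≡⟨ ℚ+.∑-congᴬ (λ ν≤M → ℚ+.∑-congᴬ (λ y≤M → restrictedTerm-∷ʳ M c ν≤M y≤M) (all-upTo (suc M)))
                  (allVecs-bounded M k) ⟩
  ℚ+.∑ (allVecs M k) (λ ν → ℚ+.∑ (alphabet M) (λ y → lastLetter M c y * restrictedTerm M (remove y c) ν))
    ≡⟨ ℚ+.∑-swap (allVecs M k) (alphabet M) (λ ν y → lastLetter M c y * restrictedTerm M (remove y c) ν) ⟩
  ℚ+.∑ (alphabet M) (λ y → ℚ+.∑ (allVecs M k) (λ ν → lastLetter M c y * restrictedTerm M (remove y c) ν))
    ≡⟨ ℚ+.∑-cong (alphabet M) (λ y → sym (*-∑ (lastLetter M c y) (allVecs M k) _)) ⟩
  ℚ+.∑ (alphabet M) (λ y → lastLetter M c y * profileSum M k (remove y c)) ∎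
  where open ≡-Reasoning

lastLetter-contribution : ∀ M c {y t} T → y ℕ.< suc M → c y ≡ suc t →
  recipℕ (T ℕ.* (2 ℕ.* y) !) * recipℕ (rhsProd M (remove y c)) ≡ recipℕ (T ℕ.* rhsProd M c) * ι (suc t ℕ.* weight y)
lastLetter-contribution M c {y} {t} T y≤M cy≡1+t = begin
  recipℕ (T ℕ.* F) * recipℕ R′            ≡⟨ sym (recipℕ-* (T ℕ.* F) R′) ⟩
  recipℕ (T ℕ.* F ℕ.* R′)                  ≡⟨ sym (recipℕ-cancel {m} (T ℕ.* F ℕ.* R′) (ℕ.s≤s ℕ.z≤n)) ⟩
  recipℕ (m ℕ.* (T ℕ.* F ℕ.* R′)) * ι m    ≡⟨ cong (λ n → recipℕ n * ι m) denominator ⟩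
  recipℕ (T ℕ.* rhsProd M c) * ι m         ∎
  where
  open ≡-Reasoning
  F = (2 ℕ.* y) !
  R′ = rhsProd M (remove y c)
  m = suc t ℕ.* weight y
  regroup : ∀ m T F R → m ℕ.* (T ℕ.* F ℕ.* R) ≡ T ℕ.* (m ℕ.* (F ℕ.* R))
  regroup = solve-∀
  denominator : m ℕ.* (T ℕ.* F ℕ.* R′) ≡ T ℕ.* rhsProd M c
  denominator = trans (regroup m T F R′) (cong (T ℕ.*_) (sym (rhs-remove M c y≤M cy≡1+t)))

∑≡0 : ∀ xs (c : ℕ → ℕ) → ℕ+.∑ xs c ≡ 0 → All (λ j → c j ≡ 0) xs
∑≡0 [] c _ = []
∑≡0 (x ∷ xs) c e = NP.m+n≡0⇒m≡0 (c x) e ∷ ∑≡0 xs c (NP.m+n≡0⇒n≡0 (c x) e)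

profileSum-empty : ∀ M c → ℕ+.∑ (alphabet M) c ≡ 0 → profileSum M 0 c ≡ recipℕ (rhsProd M c)
profileSum-empty M c Σc≡0 = begin
  restrictedTerm M c [] + 0ℚ    ≡⟨ QP.+-identityʳ _ ⟩
  restrictedTerm M c []         ≡⟨ cong (λ b → if b then term [] else 0ℚ) (T-≡ .Equivalence.to empty-profile) ⟩
  recipℕ 1                      ≡⟨ cong recipℕ (sym rhs≡1) ⟩
  recipℕ (rhsProd M c)          ∎
  where
  open ≡-Reasoning
  zeros = ∑≡0 (alphabet M) c Σc≡0
  empty-profile : T (hasProfile M c [])
  empty-profile = allᵇ-complete (alphabet M) _ (All.map (λ {j} cj≡0 → NP.≡⇒≡ᵇ 0 (c j) (sym cj≡0)) zeros)
  rhs≡1 : rhsProd M c ≡ 1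
  rhs≡1 = trans (ℕ*.∑-congᴬ (λ {j} cj≡0 → cong (λ n → n ! ℕ.* (weight j !) ℕ.^ n) cj≡0) zeros)
                (ℕ*.∑-ε (alphabet M))

profileSum-closed : ∀ M k c → ℕ+.∑ (alphabet M) c ≡ k → profileSum M k c ≡ recipℕ (rhsProd M c)
profileSum-closed M zero c Σc≡0 = profileSum-empty M c Σc≡0
profileSum-closed M (suc k) c Σc≡1+k = begin
  profileSum M (suc k) c                                                     ≡⟨ profileSum-∷ʳ M k c ⟩
  ℚ+.∑ (alphabet M) (λ y → lastLetter M c y * profileSum M k (remove y c))   ≡⟨ ℚ+.∑-congᴬ letter (all-upTo (suc M)) ⟩
  ℚ+.∑ (alphabet M) (λ y → recipℕ (W ℕ.* R) * ι (c y ℕ.* weight y))          ≡⟨ sym (*-∑ (recipℕ (W ℕ.* R)) (alphabet M) _) ⟩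
  recipℕ (W ℕ.* R) * ℚ+.∑ (alphabet M) (λ y → ι (c y ℕ.* weight y))          ≡⟨ cong (recipℕ (W ℕ.* R) *_) (∑-ι (alphabet M) (λ y → c y ℕ.* weight y)) ⟩
  recipℕ (W ℕ.* R) * ι W                                                     ≡⟨ recipℕ-cancel R W>0 ⟩
  recipℕ R                                                                   ∎
  where
  open ≡-Reasoning
  W = totalWeight M c
  R = rhsProd M c
  W>0 : 0 ℕ.< W
  W>0 = NP.<-≤-trans (ℕ.s≤s ℕ.z≤n) (NP.≤-trans (NP.≤-reflexive (sym Σc≡1+k)) (length≤totalWeight M c))
  letter : ∀ {y} → y ℕ.< suc M → lastLetter M c y * profileSum M k (remove y c) ≡ recipℕ (W ℕ.* R) * ι (c y ℕ.* weight y)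
  letter {y} y≤M with c y in cy
  ... | zero  = trans (QP.*-zeroˡ (profileSum M k (remove y c))) (sym (QP.*-zeroʳ (recipℕ (W ℕ.* R))))
  ... | suc t = trans (cong (recipℕ (W ℕ.* (2 ℕ.* y) !) *_) (profileSum-closed M k (remove y c) Σc′≡k))
                      (lastLetter-contribution M c W y≤M cy)
    where
    Σc′≡k : ℕ+.∑ (alphabet M) (remove y c) ≡ k
    Σc′≡k = NP.suc-injective (trans (sym (remove-length M c y≤M cy)) Σc≡1+k)

maxV-bound : ∀ {k} (ν : Vec ℕ k) → VA.All (ℕ._< suc (maxV ν)) ν
maxV-bound [] = VA.[]
maxV-bound (x ∷ ν) = ℕ.s≤s (NP.m≤m⊔n x (maxV ν))
  VA.∷ VA.map (λ z≤max → NP.≤-trans z≤max (ℕ.s≤s (NP.m≤n⊔m x (maxV ν)))) (maxV-bound ν)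

profile-length : ∀ M {k} (ν : Vec ℕ k) → VA.All (ℕ._< suc M) ν → ℕ+.∑ (alphabet M) (λ j → count j ν) ≡ k
profile-length M {k} ν ν≤M = begin
  ℕ+.∑ (alphabet M) (λ j → count j ν)         ≡⟨ ℕ+.∑-cong (alphabet M) (λ j → sym (NP.*-identityʳ (count j ν))) ⟩
  ℕ+.∑ (alphabet M) (λ j → count j ν ℕ.* 1)   ≡⟨ count-∑ M (λ _ → 1) ν ν≤M ⟩
  V.sum (V.map (λ _ → 1) ν)                   ≡⟨ sum-ones ν ⟩
  k                                           ∎
  where
  open ≡-Reasoning
  sum-ones : ∀ {n} (v : Vec ℕ n) → V.sum (V.map (λ _ → 1) v) ≡ n
  sum-ones [] = refl
  sum-ones (_ ∷ v) = cong suc (sum-ones v)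

-- Lemma 3.3.
lemma3p3 : (k : ℕ) → k ≥ 1 → (μ : Vec ℕ k) → Decreasing μ →
    w μ ≡ recipℕ (rhsDenom μ)
lemma3p3 k _ μ _ = begin
  w μ                                                          ≡⟨ ℚ+.∑-foldr-map (𝒫 μ) term ⟩
  ℚ+.∑ (𝒫 μ) term                                              ≡⟨ ℚ+.∑-filter (allVecs M k) (λ ν → isRearrᵇ M ν μ) term ⟩
  profileSum M k (λ j → count j μ)                             ≡⟨ profileSum-closed M k (λ j → count j μ) (profile-length M μ (maxV-bound μ)) ⟩
  recipℕ (rhsDenom μ)                                          ∎
  where
  open ≡-Reasoning
  M = maxV μ
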